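{- For every integer $n\ge 4$, $px_{n-1,2}(K_n)=2$.
   Context: All graphs are finite, simple and undirected; edge-colorings need not be proper. In an edge-colored graph, a tree $T$ is a proper tree if no two adjacent edges of $T$ receive the same color. For a connected graph $G$ and $S\subseteq V(G)$ with $|S|\ge 2$, an $S$-tree is a tree in $G$ containing all vertices of $S$. $S$-trees $T_1,\dots,T_\ell$ are internally disjoint if $E(T_i)\cap E(T_j)=\emptyset$ and $V(T_i)\cap V(T_j)=S$ for all $i\ne j$. For a $k$-subset $S$, $\kappa(S)$ is the maximum number of internally disjoint $S$-trees in $G$, and $\kappa_k(G)=\min\{\kappa(S): S\subseteq V(G),|S|=k\}$. For integers $2\le k\le |V(G)|$ and $1\le \ell\le \kappa_k(G)$, the $(k,\ell)$-proper index $px_{k,\ell}(G)$ is the minimum number of colors in an edge-coloring of $G$ such that for every $k$-subset $S$ of $V(G)$ there exist $\ell$ internally disjoint proper $S$-trees. $K_n$ denotes the complete graph on $n$ vertices. -}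

module Defs where

open import Data.Nat using (ℕ; zero; suc; _<_)
open import Data.Fin using (Fin; zero; suc; inject₁; fromℕ)
open import Data.Fin.Subset using (Subset; _∈_; _∉_; ∣_∣)
open import Data.Bool using (Bool; true; false)
open import Data.Product using (Σ; ∃; _×_; _,_)
open import Relation.Binary.PropositionalEquality using (_≡_; _≢_)
open import Relation.Binary.Construct.Closure.ReflexiveTransitive using (Star)
open import Relation.Nullary using (¬_)
open import Function.Definitions using (Injective)

-- The complete graph K_n has vertex set Fin n and an edge between any two
-- distinct vertices.

-- An edge-colouring of K_n with (at most) m colours: a symmetric function on
-- pairs of vertices (values on the diagonal are irrelevant, as there are no
-- loops).
record Coloring (n m : ℕ) : Set where
  field
    col : Fin n → Fin n → Fin m
    sym : ∀ u v → col u v ≡ col v u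
open Coloring public

record Subgraph (n : ℕ) : Set where
  field
    V : Subset n
    E : Fin n → Fin n → Bool
    E-sym : ∀ u v → E u v ≡ E v u
    E-irr : ∀ u → E u u ≡ false
    E-inV : ∀ u v → E u v ≡ true → u ∈ V × v ∈ V
open Subgraph public

Adj : ∀ {n} → Subgraph n → Fin n → Fin n → Set
Adj H u v = E H u v ≡ true

Connected : ∀ {n} → Subgraph n → Set
Connected H = ∀ u v → u ∈ V H → v ∈ V H → Star (Adj H) u v

Cycle : ∀ {n} → Subgraph n → Set
Cycle {n} H =
  Σ ℕ λ k → Σ (Fin (suc (suc (suc k))) → Fin n) λ f →
    Injective _≡_ _≡_ f
    × (∀ (i : Fin (suc (suc k))) → Adj H (f (inject₁ i)) (f (suc i)))
    × Adj H (f (fromℕ (suc (suc k)))) (f zero)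

Acyclic : ∀ {n} → Subgraph n → Set
Acyclic H = ¬ Cycle H

IsTree : ∀ {n} → Subgraph n → Set
IsTree H = Connected H × Acyclic H

IsSTree : ∀ {n} → Subset n → Subgraph n → Set
IsSTree {n} S T = IsTree T × (∀ (v : Fin n) → v ∈ S → v ∈ V T)

IsProper : ∀ {n m} → Coloring n m → Subgraph n → Set
IsProper c T = ∀ u v w → v ≢ w → Adj T u v → Adj T u w →
  col c u v ≢ col c u w

-- internally disjoint S-trees T₁, T₂: no common edge, and V(T₁) ∩ V(T₂) ⊆ S
-- (together with S ⊆ V(Tᵢ) this gives V(T₁) ∩ V(T₂) = S)
InternallyDisjoint : ∀ {n} → Subset n → Subgraph n → Subgraph n → Set
InternallyDisjoint S T₁ T₂ =
  (∀ u v → Adj T₁ u v → ¬ Adj T₂ u v)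
  × (∀ v → v ∈ V T₁ → v ∈ V T₂ → v ∈ S)

Good : ∀ {n m} → ℕ → ℕ → Coloring n m → Set
Good {n} k ℓ c = ∀ (S : Subset n) → ∣ S ∣ ≡ k →
  Σ (Fin ℓ → Subgraph n) λ T →
    (∀ i → IsSTree S (T i) × IsProper c (T i))
    × (∀ i j → i ≢ j → InternallyDisjoint S (T i) (T j))

ProperIndexIs : ℕ → ℕ → ℕ → ℕ → Set
ProperIndexIs n k ℓ p =
  (Σ (Coloring n p) λ c → Good k ℓ c)
  × (∀ m → m < p → (c : Coloring n m) → ¬ Good k ℓ c)

module Submission where

-- With a single colour a proper tree has maximum degree one,
-- so a connected proper subgraph cannot contain three vertices, while an
-- (n-1)-set does (and with no colours K_n cannot be coloured at all).
--
-- Colour the edges of the Hamiltonian cycle 0, 1, …, n-1, 0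
-- with colour 0 and all chords with colour 1.  An (n-1)-set is V ∖ {x}, so
-- it suffices to find, for each x, an "avoiding pair": two edge-disjoint
-- proper trees covering V ∖ {x}, not both through x.  The rotation i ↦ i+1
-- preserves the colouring and transports avoiding pairs, so only x = 0
-- matters.  There both trees are zig-zag paths, 2,1,4,3,6,5,… on {1,…,n-1}
-- and 1,0,3,2,5,4,… on {0,…,n-1} (for n = 4 the second one is 1,0,2,3).
-- Their edges alternate between cycle edges and chords, so they are proper;
-- the smaller end of every edge is odd on the first path and even on the
-- second, so they are edge-disjoint.  A path is given by its vertex sequence
-- together with the inverse "position" map, which is a rank changing by
-- exactly one along every edge; such a rank rules out cycles.

open import Defs
open import Data.Nat using (ℕ; zero; suc; _+_; _≤_; _<_; _∸_; _⊓_; z≤n; s≤s)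
open import Data.Nat.Base using (parity)
open import Data.Nat.Properties
  using (≤-trans; ≤-refl; <-irrefl; n≤1+n; 1+n≢n; suc-injective; +-suc; +-identityʳ;
         m≢1+m+n; m+1+n≢m; m≤m+n; +-monoʳ-<; m+n∸m≡n; m+[n∸m]≡n; ∸-monoˡ-<; m≤n⇒m⊓n≡m; ⊓-comm; _<?_)
  renaming (_≟_ to _≟ℕ_)
open import Data.Nat.DivMod using (_mod_; m<n⇒m%n≡m)
open import Data.Parity.Base using (Parity; 0ℙ; 1ℙ) renaming (_+_ to _+ℙ_)
open import Data.Parity.Properties using (p≢p⁻¹; ⁻¹-selfInverse; suc-homo-⁻¹; +-homo-+)
  renaming (+-identityʳ to ℙ-+-identityʳ)
open import Data.Fin using (Fin; zero; suc; toℕ; fromℕ; inject₁)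
open import Data.Fin.Properties using (_≟_; toℕ-injective; toℕ<n; toℕ-fromℕ; toℕ-fromℕ<; toℕ-inject₁)
import Data.Fin.Properties as Fin
open import Data.Fin.Induction using (<-weakInduction)
open import Data.Fin.Relation.Unary.Top using (view; ‵fromℕ; ‵inj₁; view-fromℕ; view-inject₁)
open import Data.Fin.Permutation using (Permutation′; permutation; _⟨$⟩ʳ_; _⟨$⟩ˡ_; inverseˡ; inverseʳ)
open import Data.Fin.Subset using (Subset; _∈_; _∉_; ∣_∣; ⊤)
open import Data.Fin.Subset.Properties using (∈⊤; ∣⊤∣≡n; ∣p∣≡n⇒p≡⊤)
open import Data.Vec using ([]; _∷_; here; there; tabulate; lookup)
open import Data.Vec.Properties using (lookup∘tabulate; []=⇒lookup; lookup⇒[]=)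
open import Data.Bool using (Bool; true; false; if_then_else_)
open import Data.Product using (∃; _×_; _,_; proj₁; proj₂)
open import Data.Sum using (_⊎_; inj₁; inj₂)
import Data.Sum as Sum
open import Data.Empty using (⊥; ⊥-elim)
open import Function using (_∘_)
open import Function.Bundles using (mk⇔)
open import Function.Definitions using (Injective)
open import Relation.Nullary using (¬_; Dec; yes; no; does)
open import Relation.Nullary.Decidable using (_×-dec_; _⊎-dec_; dec-true; dec-false; does-⇔)
open import Relation.Binary.PropositionalEquality
  using (_≡_; _≢_; refl; trans; cong; cong₂; subst; subst₂; module ≡-Reasoning)
  renaming (sym to ≡-sym)
open import Relation.Binary.Construct.Closure.ReflexiveTransitive
  using (Star; ε; _◅_; _◅◅_; gmap; reverse)

open ≡-Reasoning

fromDoes : ∀ {A : Set} (a? : Dec A) → does a? ≡ true → A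
fromDoes (yes a) _ = a
fromDoes (no _) ()

∈-tabulate⁺ : ∀ {n} {f : Fin n → Bool} {w} → f w ≡ true → w ∈ tabulate f
∈-tabulate⁺ {f = f} {w} fw = lookup⇒[]= w (tabulate f) (trans (lookup∘tabulate f w) fw)

∈-tabulate⁻ : ∀ {n} {f : Fin n → Bool} {w} → w ∈ tabulate f → f w ≡ true
∈-tabulate⁻ {f = f} {w} w∈ = trans (≡-sym (lookup∘tabulate f w)) ([]=⇒lookup w∈)

complement-of-point : ∀ {n} (S : Subset (suc n)) → ∣ S ∣ ≡ n →
  ∃ λ x → x ∉ S × (∀ v → v ≢ x → v ∈ S)
complement-of-point (false ∷ S) ∣S∣≡n =
  zero , (λ ()) , λ { zero 0≢0 → ⊥-elim (0≢0 refl)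
                    ; (suc v) _ → there (subst (v ∈_) (≡-sym (∣p∣≡n⇒p≡⊤ ∣S∣≡n)) ∈⊤) }
complement-of-point {zero} (true ∷ []) ()
complement-of-point {suc n} (true ∷ S) ∣S∣≡n with complement-of-point S (suc-injective ∣S∣≡n)
... | x , x∉S , others =
  suc x , (λ { (there x∈S) → x∉S x∈S }) ,
  λ { zero _ → here ; (suc v) v≢x → there (others v (v≢x ∘ cong suc)) }

-- In a proper subgraph of a 1-coloured K_n every vertex has at most one
-- neighbour, so walks collapse to single edges and a connected such
-- subgraph has at most two vertices.
module SingleColour {n} (c : Coloring n 1) (T : Subgraph n) (proper : IsProper c T) where

  unique-neighbour : ∀ {u v w} → Adj T u v → Adj T u w → v ≡ w
  unique-neighbour {u} {v} {w} uv uw with v ≟ w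
  ... | yes v≡w = v≡w
  ... | no v≢w = ⊥-elim (proper u v w v≢w uv uw (one-colour (col c u v) (col c u w)))
    where
    one-colour : (a b : Fin 1) → a ≡ b
    one-colour zero zero = refl

  walk-collapses : ∀ {u v} → Star (Adj T) u v → u ≡ v ⊎ Adj T u v
  walk-collapses ε = inj₁ refl
  walk-collapses {u} (_◅_ {j = w} uw wv) with walk-collapses wv
  ... | inj₁ refl = inj₂ uw
  ... | inj₂ wv′ = inj₁ (unique-neighbour (trans (E-sym T w u) uw) wv′)

  no-three-vertices : Connected T → ∀ {u v w} → u ∈ V T → v ∈ V T → w ∈ V T →
    u ≢ v → u ≢ w → v ≡ w
  no-three-vertices connected {u} u∈ v∈ w∈ u≢v u≢w =
    unique-neighbour (adjacent v∈ u≢v) (adjacent w∈ u≢w)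
    where
    adjacent : ∀ {z} → z ∈ V T → u ≢ z → Adj T u z
    adjacent {z} z∈ u≢z with walk-collapses (connected u z u∈ z∈)
    ... | inj₁ u≡z = ⊥-elim (u≢z u≡z)
    ... | inj₂ uz = uz

-- For n ≥ 4 fewer than two colours fail already for the set {1, …, n-1}:
-- a proper tree through 1, 2 and 3 would contain three vertices.
fewer-than-two-colours-fail : ∀ k m → m < 2 → (c : Coloring (4 + k) m) → ¬ Good (3 + k) 2 c
fewer-than-two-colours-fail k zero _ c _ with col c zero zero
... | ()
fewer-than-two-colours-fail k (suc zero) _ c good
  with good (false ∷ ⊤) (∣⊤∣≡n (3 + k))
... | trees , is-tree , _ with is-tree zero
...   | ((connected , _) , covers) , proper
  with () ← SingleColour.no-three-vertices c (trees zero) proper connected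
              (covers (suc zero) (there ∈⊤)) (covers (suc (suc zero)) (there ∈⊤))
              (covers (suc (suc (suc zero))) (there ∈⊤)) (λ ()) (λ ())
fewer-than-two-colours-fail k (suc (suc m)) (s≤s (s≤s ()))

-- What (n-1, 2)-goodness asks for at the set V ∖ {x}: two proper trees
-- containing every vertex other than x, edge-disjoint, not both through x.
record AvoidingPair {n k} (c : Coloring n k) (x : Fin n) : Set where
  field
    tree₁ tree₂ : Subgraph n
    isTree₁ : IsTree tree₁
    isTree₂ : IsTree tree₂
    proper₁ : IsProper c tree₁
    proper₂ : IsProper c tree₂
    covers₁ : ∀ v → v ≢ x → v ∈ V tree₁
    covers₂ : ∀ v → v ≢ x → v ∈ V tree₂
    edge-disjoint : ∀ u v → Adj tree₁ u v → ¬ Adj tree₂ u v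
    not-both : x ∈ V tree₁ → x ∉ V tree₂

avoiding-pairs⇒good : ∀ {n k} (c : Coloring (suc n) k) → (∀ x → AvoidingPair c x) → Good n 2 c
avoiding-pairs⇒good c pairs S ∣S∣≡n with complement-of-point S ∣S∣≡n
... | x , x∉S , others = trees , is-S-tree , disjoint
  where
  open AvoidingPair (pairs x)

  trees : Fin 2 → Subgraph _
  trees zero = tree₁
  trees (suc zero) = tree₂

  not-x : ∀ v → v ∈ S → v ≢ x
  not-x v v∈S refl = x∉S v∈S

  is-S-tree : ∀ i → IsSTree S (trees i) × IsProper c (trees i)
  is-S-tree zero = (isTree₁ , λ v v∈S → covers₁ v (not-x v v∈S)) , proper₁
  is-S-tree (suc zero) = (isTree₂ , λ v v∈S → covers₂ v (not-x v v∈S)) , proper₂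

  shared⇒in-S : ∀ v → v ∈ V tree₁ → v ∈ V tree₂ → v ∈ S
  shared⇒in-S v v∈₁ v∈₂ with v ≟ x
  ... | yes refl = ⊥-elim (not-both v∈₁ v∈₂)
  ... | no v≢x = others v v≢x

  disjoint : ∀ i j → i ≢ j → InternallyDisjoint S (trees i) (trees j)
  disjoint zero zero i≢j = ⊥-elim (i≢j refl)
  disjoint zero (suc zero) _ = edge-disjoint , shared⇒in-S
  disjoint (suc zero) zero _ =
    (λ u v uv₂ uv₁ → edge-disjoint u v uv₁ uv₂) , λ v v∈₂ v∈₁ → shared⇒in-S v v∈₁ v∈₂
  disjoint (suc zero) (suc zero) i≢j = ⊥-elim (i≢j refl)

ColourAutomorphism : ∀ {n k} → Coloring n k → Permutation′ n → Set
ColourAutomorphism c π = ∀ u v → col c (π ⟨$⟩ʳ u) (π ⟨$⟩ʳ v) ≡ col c u v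

module Relabel {n} (π : Permutation′ n) where

  private
    to from : Fin n → Fin n
    to u = π ⟨$⟩ʳ u
    from u = π ⟨$⟩ˡ u

  from-injective : ∀ {u v} → from u ≡ from v → u ≡ v
  from-injective {u} {v} e = trans (≡-sym (inverseʳ π)) (trans (cong to e) (inverseʳ π))

  image-set : Subset n → Subset n
  image-set S = tabulate (λ w → lookup S (from w))

  ∈-image⁺ : ∀ {S w} → from w ∈ S → w ∈ image-set S
  ∈-image⁺ w∈ = ∈-tabulate⁺ ([]=⇒lookup w∈)

  ∈-image⁻ : ∀ {S w} → w ∈ image-set S → from w ∈ S
  ∈-image⁻ {S} {w} w∈ = lookup⇒[]= (from w) S (∈-tabulate⁻ w∈)

  image : Subgraph n → Subgraph n
  image H = record
    { V = image-set (V H)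
    ; E = λ w z → E H (from w) (from z)
    ; E-sym = λ w z → E-sym H (from w) (from z)
    ; E-irr = λ w → E-irr H (from w)
    ; E-inV = λ w z wz → ∈-image⁺ (proj₁ (E-inV H _ _ wz)) , ∈-image⁺ (proj₂ (E-inV H _ _ wz))
    }

  adj-image : ∀ H {u v} → Adj H u v → Adj (image H) (to u) (to v)
  adj-image H = subst₂ (λ a b → E H a b ≡ true) (≡-sym (inverseˡ π)) (≡-sym (inverseˡ π))

  image-connected : ∀ H → Connected H → Connected (image H)
  image-connected H connected w z w∈ z∈ =
    subst₂ (Star (Adj (image H))) (inverseʳ π) (inverseʳ π)
      (gmap to (adj-image H) (connected (from w) (from z) (∈-image⁻ w∈) (∈-image⁻ z∈)))

  image-acyclic : ∀ H → Acyclic H → Acyclic (image H)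
  image-acyclic H acyclic (k , f , f-injective , steps , closing) =
    acyclic (k , from ∘ f , (λ e → f-injective (from-injective e)) , steps , closing)

  module _ {k} {c : Coloring n k} (automorphism : ColourAutomorphism c π) where

    colour-from : ∀ u v → col c (from u) (from v) ≡ col c u v
    colour-from u v = trans (≡-sym (automorphism (from u) (from v))) (cong₂ (col c) (inverseʳ π) (inverseʳ π))

    image-proper : ∀ H → IsProper c H → IsProper c (image H)
    image-proper H proper u v w v≢w uv uw same =
      proper (from u) (from v) (from w) (v≢w ∘ from-injective) uv uw
        (trans (colour-from u v) (trans same (≡-sym (colour-from u w))))

    transport : ∀ {x} → AvoidingPair c x → AvoidingPair c (to x)
    transport {x} pair = record
      { tree₁ = image tree₁
      ; tree₂ = image tree₂
      ; isTree₁ = image-connected tree₁ (proj₁ isTree₁) , image-acyclic tree₁ (proj₂ isTree₁)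
      ; isTree₂ = image-connected tree₂ (proj₁ isTree₂) , image-acyclic tree₂ (proj₂ isTree₂)
      ; proper₁ = image-proper tree₁ proper₁
      ; proper₂ = image-proper tree₂ proper₂
      ; covers₁ = λ v v≢ → ∈-image⁺ (covers₁ (from v) (from-not-x v≢))
      ; covers₂ = λ v v≢ → ∈-image⁺ (covers₂ (from v) (from-not-x v≢))
      ; edge-disjoint = λ u v → edge-disjoint (from u) (from v)
      ; not-both = λ x∈₁ x∈₂ → not-both (back (∈-image⁻ x∈₁)) (back (∈-image⁻ x∈₂))
      }
      where
      open AvoidingPair pair
      from-not-x : ∀ {v} → v ≢ to x → from v ≢ x
      from-not-x {v} v≢ refl = v≢ (≡-sym (inverseʳ π))
      back : ∀ {S} → from (to x) ∈ S → x ∈ S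
      back = subst (_∈ _) (inverseˡ π)

Consecutive : ℕ → ℕ → Set
Consecutive a b = suc a ≡ b ⊎ suc b ≡ a

consecutive? : ∀ a b → Dec (Consecutive a b)
consecutive? a b = (suc a ≟ℕ b) ⊎-dec (suc b ≟ℕ a)

consecutive-irrefl : ∀ {a} → ¬ Consecutive a a
consecutive-irrefl (inj₁ e) = 1+n≢n e
consecutive-irrefl (inj₂ e) = 1+n≢n e

distant-not-consecutive : ∀ a d → ¬ Consecutive (a + suc (suc d)) a
distant-not-consecutive a d (inj₁ e) = m≢1+m+n a (≡-sym e)
distant-not-consecutive a d (inj₂ e) =
  m+1+n≢m a (≡-sym (suc-injective (trans e (+-suc a (suc d)))))

Ascending Descending : ∀ {m} → (Fin (suc m) → ℕ) → Set
Ascending {m} s = ∀ (i : Fin m) → suc (s (inject₁ i)) ≡ s (suc i)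
Descending {m} s = ∀ (i : Fin m) → suc (s (suc i)) ≡ s (inject₁ i)

-- An injective sequence moving by ±1 at each step never turns back: a turn
-- would repeat the value two steps earlier.
steps-monotone : ∀ m (s : Fin (suc m) → ℕ) → Injective _≡_ _≡_ s →
  (∀ (i : Fin m) → Consecutive (s (inject₁ i)) (s (suc i))) → Ascending s ⊎ Descending s
steps-monotone zero s _ _ = inj₁ (λ ())
steps-monotone (suc zero) s _ step with step zero
... | inj₁ up = inj₁ λ { zero → up }
... | inj₂ down = inj₂ λ { zero → down }
steps-monotone (suc (suc m)) s s-injective step
  with step zero | steps-monotone (suc m) (s ∘ suc) (λ e → Fin.suc-injective (s-injective e)) (step ∘ suc)
... | inj₁ up | inj₁ ups = inj₁ λ { zero → up ; (suc i) → ups i }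
... | inj₂ down | inj₂ downs = inj₂ λ { zero → down ; (suc i) → downs i }
... | inj₁ up | inj₂ downs
  with () ← s-injective {zero} {suc (suc zero)} (suc-injective (trans up (≡-sym (downs zero))))
... | inj₂ down | inj₁ ups
  with () ← s-injective {zero} {suc (suc zero)} (trans (≡-sym down) (ups zero))

ascending-span : ∀ m (s : Fin (suc m) → ℕ) → Ascending s → s (fromℕ m) ≡ s zero + m
ascending-span zero s _ = ≡-sym (+-identityʳ _)
ascending-span (suc m) s up = begin
  s (fromℕ (suc m))  ≡⟨ ascending-span m (s ∘ suc) (up ∘ suc) ⟩
  s (suc zero) + m   ≡⟨ cong (_+ m) (≡-sym (up zero)) ⟩
  suc (s zero) + m   ≡⟨ ≡-sym (+-suc (s zero) m) ⟩
  s zero + suc m     ∎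

descending-span : ∀ m (s : Fin (suc m) → ℕ) → Descending s → s zero ≡ s (fromℕ m) + m
descending-span zero s _ = ≡-sym (+-identityʳ _)
descending-span (suc m) s down = begin
  s zero                       ≡⟨ ≡-sym (down zero) ⟩
  suc (s (suc zero))           ≡⟨ cong suc (descending-span m (s ∘ suc) (down ∘ suc)) ⟩
  suc (s (fromℕ (suc m)) + m)  ≡⟨ ≡-sym (+-suc _ m) ⟩
  s (fromℕ (suc m)) + suc m    ∎

-- If adjacent vertices of H have consecutive ranks and the rank is injective
-- on V(H), then H has no cycle: ranks along a cycle would be monotone, so the
-- last and first vertex of the cycle would be too far apart to be adjacent.
acyclic-by-rank : ∀ {n} (H : Subgraph n) (rank : Fin n → ℕ) →
  (∀ {u v} → Adj H u v → Consecutive (rank u) (rank v)) →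
  (∀ {u v} → u ∈ V H → v ∈ V H → rank u ≡ rank v → u ≡ v) → Acyclic H
acyclic-by-rank H rank step rank-injective (k , f , f-injective , edges , closing) =
  closes (steps-monotone (suc (suc k)) s s-injective (λ i → step (edges i)))
  where
  s : Fin (suc (suc (suc k))) → ℕ
  s = rank ∘ f

  on-H : ∀ i → f i ∈ V H
  on-H zero = proj₂ (E-inV H _ _ closing)
  on-H (suc i) = proj₂ (E-inV H _ _ (edges i))

  s-injective : Injective _≡_ _≡_ s
  s-injective e = f-injective (rank-injective (on-H _) (on-H _) e)

  closes : Ascending s ⊎ Descending s → ⊥
  closes (inj₁ up) = distant-not-consecutive (s zero) k
    (subst (λ a → Consecutive a (s zero)) (ascending-span _ s up) (step closing))
  closes (inj₂ down) = distant-not-consecutive (s (fromℕ (suc (suc k)))) k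
    (subst (λ a → Consecutive a (s (fromℕ (suc (suc k))))) (descending-span _ s down)
      (Sum.swap (step closing)))

record IndexedPath (n : ℕ) : Set where
  field
    len : ℕ
    vertex : ℕ → Fin n
    position : Fin n → ℕ
    position-vertex : ∀ {j} → j < len → position (vertex j) ≡ j

module PathGraph {n} (P : IndexedPath n) where
  open IndexedPath P

  OnPath : Fin n → Set
  OnPath v = position v < len × vertex (position v) ≡ v

  Link : Fin n → Fin n → Set
  Link u v = OnPath u × OnPath v × Consecutive (position u) (position v)

  onPath? : ∀ v → Dec (OnPath v)
  onPath? v = (position v <? len) ×-dec (vertex (position v) ≟ v)

  link? : ∀ u v → Dec (Link u v)
  link? u v = onPath? u ×-dec onPath? v ×-dec consecutive? (position u) (position v)

  link-sym : ∀ {u v} → Link u v → Link v u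
  link-sym (on-u , on-v , c) = on-v , on-u , Sum.swap c

  graph : Subgraph n
  graph = record
    { V = tabulate (λ v → does (onPath? v))
    ; E = λ u v → does (link? u v)
    ; E-sym = λ u v → does-⇔ (mk⇔ link-sym link-sym) (link? u v) (link? v u)
    ; E-irr = λ u → dec-false (link? u u) (consecutive-irrefl ∘ proj₂ ∘ proj₂)
    ; E-inV = λ u v uv → let (on-u , on-v , _) = fromDoes (link? u v) uv
                         in ∈-tabulate⁺ (dec-true (onPath? u) on-u) , ∈-tabulate⁺ (dec-true (onPath? v) on-v)
    }

  ∈graph⁺ : ∀ {v} → OnPath v → v ∈ V graph
  ∈graph⁺ {v} on-v = ∈-tabulate⁺ (dec-true (onPath? v) on-v)

  ∈graph⁻ : ∀ {v} → v ∈ V graph → OnPath v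
  ∈graph⁻ {v} v∈ = fromDoes (onPath? v) (∈-tabulate⁻ v∈)

  adj⁻ : ∀ {u v} → Adj graph u v → Link u v
  adj⁻ {u} {v} = fromDoes (link? u v)

  on-path : ∀ {j} → j < len → OnPath (vertex j)
  on-path {j} j<len rewrite position-vertex j<len = j<len , refl

  position-injective : ∀ {u v} → OnPath u → OnPath v → position u ≡ position v → u ≡ v
  position-injective (_ , u≡) (_ , v≡) e = trans (≡-sym u≡) (trans (cong vertex e) v≡)

  step : ∀ {j} → suc j < len → Adj graph (vertex j) (vertex (suc j))
  step {j} sj<len = dec-true (link? _ _)
    (on-path j<len , on-path sj<len ,
     inj₁ (trans (cong suc (position-vertex j<len)) (≡-sym (position-vertex sj<len))))
    where j<len = ≤-trans (n≤1+n _) sj<len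

  walk-from-start : ∀ {j} → j < len → Star (Adj graph) (vertex 0) (vertex j)
  walk-from-start {zero} _ = ε
  walk-from-start {suc j} sj<len = walk-from-start (≤-trans (n≤1+n _) sj<len) ◅◅ (step sj<len ◅ ε)

  adj-sym : ∀ {u v} → Adj graph u v → Adj graph v u
  adj-sym {u} {v} uv = trans (E-sym graph v u) uv

  is-tree : IsTree graph
  is-tree = connected , acyclic
    where
    connected : Connected graph
    connected u v u∈ v∈ with ∈graph⁻ u∈ | ∈graph⁻ v∈
    ... | (u-pos , u≡) | (v-pos , v≡) = subst₂ (Star (Adj graph)) u≡ v≡
      (reverse adj-sym (walk-from-start u-pos) ◅◅ walk-from-start v-pos)
    acyclic : Acyclic graph
    acyclic = acyclic-by-rank graph position (proj₂ ∘ proj₂ ∘ adj⁻)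
      (λ u∈ v∈ → position-injective (∈graph⁻ u∈) (∈graph⁻ v∈))

  -- the path is proper once any two consecutive edges differ in colour
  Alternating : ∀ {k} → Coloring n k → Set
  Alternating c = ∀ j → suc (suc j) < len →
    col c (vertex j) (vertex (suc j)) ≢ col c (vertex (suc j)) (vertex (suc (suc j)))

  module _ {k} (c : Coloring n k) (alternating : Alternating c) where

    turn : ∀ {a b d} → OnPath a → OnPath b → OnPath d →
      suc (position a) ≡ position b → suc (position b) ≡ position d → col c a b ≢ col c b d
    turn {a} (_ , a≡) (_ , b≡) (d-pos , d≡) ab bd =
      subst₂ _≢_ (cong₂ (col c) a≡ b≡′) (cong₂ (col c) b≡′ d≡′) (alternating (position a) bound)
      where
      b≡′ = trans (cong vertex ab) b≡
      d≡′ = trans (cong (vertex ∘ suc) ab) (trans (cong vertex bd) d≡)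
      bound = subst (_< len) (≡-sym (trans (cong suc ab) bd)) d-pos

    proper : IsProper c graph
    proper u v w v≢w uv uw same with adj⁻ uv | adj⁻ uw
    ... | _ , on-v , inj₁ u→v | _ , on-w , inj₁ u→w =
      v≢w (position-injective on-v on-w (trans (≡-sym u→v) u→w))
    ... | _ , on-v , inj₂ v→u | _ , on-w , inj₂ w→u =
      v≢w (position-injective on-v on-w (suc-injective (trans v→u (≡-sym w→u))))
    ... | on-u , on-v , inj₁ u→v | _ , on-w , inj₂ w→u =
      turn on-w on-u on-v w→u u→v (trans (sym c w u) (≡-sym same))
    ... | on-u , on-v , inj₂ v→u | _ , on-w , inj₁ u→w =
      turn on-v on-u on-w v→u u→w (trans (sym c v u) same)

  edges-are-steps : (R : Fin n → Fin n → Set) → (∀ {u v} → R u v → R v u) →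
    (∀ j → suc j < len → R (vertex j) (vertex (suc j))) → ∀ u v → Adj graph u v → R u v
  edges-are-steps R R-sym R-steps u v uv with adj⁻ uv
  ... | (_ , u≡) , (v-pos , v≡) , inj₁ u→v =
    subst₂ R u≡ (trans (cong vertex u→v) v≡) (R-steps _ (subst (_< len) (≡-sym u→v) v-pos))
  ... | (u-pos , u≡) , (_ , v≡) , inj₂ v→u =
    R-sym (subst₂ R v≡ (trans (cong vertex v→u) u≡) (R-steps _ (subst (_< len) (≡-sym v→u) u-pos)))

colourOf : Parity → Fin 2
colourOf 0ℙ = zero
colourOf 1ℙ = suc zero

colour-alternates : ∀ j → colourOf (parity j) ≢ colourOf (parity (suc j))
colour-alternates j e = p≢p⁻¹ (parity j) (trans (injective e) (≡-sym (⁻¹-selfInverse (suc-homo-⁻¹ j))))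
  where
  injective : ∀ {p q} → colourOf p ≡ colourOf q → p ≡ q
  injective {0ℙ} {0ℙ} _ = refl
  injective {1ℙ} {1ℙ} _ = refl

lowParity : ∀ {m} → Fin m → Fin m → Parity
lowParity u v = parity (toℕ u ⊓ toℕ v)

lowParity-sym : ∀ {m} (u v : Fin m) → lowParity u v ≡ lowParity v u
lowParity-sym u v = cong parity (⊓-comm (toℕ u) (toℕ v))

-- Shapes of edges between labels a < b: a cycle step (b = a + 1, parity 0)
-- or a short chord (a + 2 ≤ b ≤ a + 3, parity 1).
data Gap : Parity → ℕ → ℕ → Set where
  short : ∀ {a} → Gap 0ℙ a (suc a)
  long : ∀ {a b} → suc (suc a) ≤ b → b ≤ 3 + a → Gap 1ℙ a b

gap-suc : ∀ {p a b} → Gap p a b → Gap p (suc a) (suc b)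
gap-suc short = short
gap-suc (long near far) = long (s≤s near) (s≤s far)

gap-shift : ∀ s {p a b} → Gap p a b → Gap p (s + a) (s + b)
gap-shift zero g = g
gap-shift (suc s) g = gap-suc (gap-shift s g)

gap-low≤high : ∀ {p a b} → Gap p a b → a ≤ b
gap-low≤high short = n≤1+n _
gap-low≤high (long near _) = ≤-trans (n≤1+n _) (≤-trans (n≤1+n _) near)

gap-high≤ : ∀ {p a b} → Gap p a b → b ≤ 3 + a
gap-high≤ short = ≤-trans (n≤1+n _) (n≤1+n _)
gap-high≤ (long _ far) = far

toℕ-mod : ∀ {a m} → a < suc m → toℕ (a mod suc m) ≡ a
toℕ-mod a< = trans (toℕ-fromℕ< _) (m<n⇒m%n≡m a<)

zigzag : ℕ → ℕ → ℕ
zigzag (suc (suc L)) zero = 1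
zigzag (suc (suc L)) (suc zero) = 0
zigzag (suc (suc L)) (suc (suc j)) = suc (suc (zigzag L j))
zigzag _ j = j

zigzag-< : ∀ L {j} → j < L → zigzag L j < L
zigzag-< (suc zero) {zero} _ = s≤s z≤n
zigzag-< (suc zero) {suc _} (s≤s ())
zigzag-< (suc (suc L)) {zero} _ = s≤s (s≤s z≤n)
zigzag-< (suc (suc L)) {suc zero} _ = s≤s z≤n
zigzag-< (suc (suc L)) {suc (suc j)} (s≤s (s≤s j<L)) = s≤s (s≤s (zigzag-< L j<L))

zigzag-involutive : ∀ L {j} → j < L → zigzag L (zigzag L j) ≡ j
zigzag-involutive (suc zero) {zero} _ = refl
zigzag-involutive (suc zero) {suc _} (s≤s ())
zigzag-involutive (suc (suc L)) {zero} _ = refl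
zigzag-involutive (suc (suc L)) {suc zero} _ = refl
zigzag-involutive (suc (suc L)) {suc (suc j)} (s≤s (s≤s j<L)) = cong (2 +_) (zigzag-involutive L j<L)

zigzag-0 : ∀ L → zigzag L 0 ≤ 1
zigzag-0 zero = z≤n
zigzag-0 (suc zero) = z≤n
zigzag-0 (suc (suc L)) = ≤-refl

record ZigzagStep (L j : ℕ) : Set where
  field
    low high : ℕ
    ends : (zigzag L j ≡ low × zigzag L (suc j) ≡ high) ⊎ (zigzag L j ≡ high × zigzag L (suc j) ≡ low)
    low-even : parity low ≡ 0ℙ
    gap : Gap (parity j) low high

zigzag-step : ∀ L j → suc j < L → ZigzagStep L j
zigzag-step (suc zero) zero (s≤s ())
zigzag-step (suc (suc L)) zero _ = record
  { low = 0 ; high = 1 ; ends = inj₂ (refl , refl) ; low-even = refl ; gap = short }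
zigzag-step (suc (suc L)) (suc zero) _ = record
  { low = 0 ; high = 2 + zigzag L 0 ; ends = inj₁ (refl , refl) ; low-even = refl
  ; gap = long (s≤s (s≤s z≤n)) (s≤s (s≤s (zigzag-0 L))) }
zigzag-step (suc (suc L)) (suc (suc j)) (s≤s (s≤s sj<L)) = record
  { low = 2 + low ; high = 2 + high
  ; ends = Sum.map (λ (x , y) → cong (2 +_) x , cong (2 +_) y) (λ (x , y) → cong (2 +_) x , cong (2 +_) y) ends
  ; low-even = low-even ; gap = gap-shift 2 gap }
  where open ZigzagStep (zigzag-step L j sj<L)

module CycleColouring (n : ℕ) where

  rotate : Fin (suc n) → Fin (suc n)
  rotate i with view i
  ... | ‵fromℕ = zero
  ... | ‵inj₁ {i = j} _ = suc j

  unrotate : Fin (suc n) → Fin (suc n)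
  unrotate zero = fromℕ n
  unrotate (suc j) = inject₁ j

  rotate-inject₁ : ∀ j → rotate (inject₁ j) ≡ suc j
  rotate-inject₁ j rewrite view-inject₁ j = refl

  rotate-unrotate : ∀ i → rotate (unrotate i) ≡ i
  rotate-unrotate zero rewrite view-fromℕ n = refl
  rotate-unrotate (suc j) = rotate-inject₁ j

  unrotate-rotate : ∀ i → unrotate (rotate i) ≡ i
  unrotate-rotate i with view i
  ... | ‵fromℕ = refl
  ... | ‵inj₁ _ = refl

  rotation : Permutation′ (suc n)
  rotation = permutation rotate unrotate rotate-unrotate unrotate-rotate

  rotate-injective : ∀ {u v} → rotate u ≡ rotate v → u ≡ v
  rotate-injective {u} {v} e = trans (≡-sym (unrotate-rotate u)) (trans (cong unrotate e) (unrotate-rotate v))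

  rotate-label : ∀ u → (toℕ u ≡ n × toℕ (rotate u) ≡ 0) ⊎ toℕ (rotate u) ≡ suc (toℕ u)
  rotate-label u with view u
  ... | ‵fromℕ = inj₁ (toℕ-fromℕ n , refl)
  ... | ‵inj₁ {i = j} _ = inj₂ (cong suc (≡-sym (toℕ-inject₁ j)))

  CycleEdge : Fin (suc n) → Fin (suc n) → Set
  CycleEdge u v = v ≡ rotate u ⊎ u ≡ rotate v

  cycleEdge? : ∀ u v → Dec (CycleEdge u v)
  cycleEdge? u v = (v ≟ rotate u) ⊎-dec (u ≟ rotate v)

  shade : ∀ u v → Fin 2
  shade u v = if does (cycleEdge? u v) then zero else suc zero

  colouring : Coloring (suc n) 2
  colouring = record
    { col = shade
    ; sym = λ u v → cong (if_then zero else suc zero) (does-⇔ (mk⇔ Sum.swap Sum.swap) (cycleEdge? u v) (cycleEdge? v u))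
    }

  rotation-automorphism : ColourAutomorphism colouring rotation
  rotation-automorphism u v = cong (if_then zero else suc zero)
    (does-⇔ (mk⇔ (Sum.map rotate-injective rotate-injective) (Sum.map (cong rotate) (cong rotate)))
            (cycleEdge? (rotate u) (rotate v)) (cycleEdge? u v))

  rotation-transitive : (P : Fin (suc n) → Set) → P zero → (∀ {u} → P u → P (rotate u)) → ∀ u → P u
  rotation-transitive P P₀ P-rotate = <-weakInduction P P₀ (λ i Pi → subst P (rotate-inject₁ i) (P-rotate Pi))

  step-is-cycle-edge : ∀ {u v} → toℕ v ≡ suc (toℕ u) → CycleEdge u v
  step-is-cycle-edge {u} {v} v≡ with rotate-label u
  ... | inj₁ (u≡n , _) = ⊥-elim (<-irrefl (trans v≡ (cong suc u≡n)) (toℕ<n v))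
  ... | inj₂ ρu≡ = inj₁ (toℕ-injective (trans v≡ (≡-sym ρu≡)))

  far-is-chord : ∀ {u v} → suc (suc (toℕ u)) ≤ toℕ v → 1 ≤ toℕ u ⊎ toℕ v < n → ¬ CycleEdge u v
  far-is-chord {u} {v} far _ (inj₁ v≡ρu) with rotate-label u
  ... | inj₁ (_ , ρu≡0) with () ← subst (suc (suc (toℕ u)) ≤_) (trans (cong toℕ v≡ρu) ρu≡0) far
  ... | inj₂ ρu≡ = <-irrefl (≡-sym (trans (cong toℕ v≡ρu) ρu≡)) far
  far-is-chord {u} {v} far not-wrap (inj₂ u≡ρv) with rotate-label v | not-wrap
  ... | inj₁ (v≡n , ρv≡0) | inj₁ 1≤u with () ← subst (1 ≤_) (trans (cong toℕ u≡ρv) ρv≡0) 1≤u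
  ... | inj₁ (v≡n , _) | inj₂ v<n = <-irrefl v≡n v<n
  ... | inj₂ ρv≡ | _ = <-irrefl refl (≤-trans (≤-trans (n≤1+n _) (n≤1+n _)) three-more)
    where
    three-more : suc (suc (suc (toℕ v))) ≤ toℕ v
    three-more = subst (λ a → suc (suc a) ≤ toℕ v) (trans (cong toℕ u≡ρv) ρv≡) far

  Ends : Fin (suc n) → Fin (suc n) → ℕ → ℕ → Set
  Ends u v a b = (toℕ u ≡ a × toℕ v ≡ b) ⊎ (toℕ u ≡ b × toℕ v ≡ a)

  gap-colour : ∀ {p a b u v} → Ends u v a b → Gap p a b → 1 ≤ a ⊎ b < n → shade u v ≡ colourOf p
  gap-colour (inj₁ (u≡ , v≡)) g not-wrap = oriented u≡ v≡ g not-wrap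
    where
    oriented : ∀ {p a b u v} → toℕ u ≡ a → toℕ v ≡ b → Gap p a b → 1 ≤ a ⊎ b < n → shade u v ≡ colourOf p
    oriented {u = u} {v} refl v≡ short _ =
      cong (if_then zero else suc zero) (dec-true (cycleEdge? u v) (step-is-cycle-edge v≡))
    oriented {u = u} {v} refl refl (long near _) not-wrap =
      cong (if_then zero else suc zero) (dec-false (cycleEdge? u v) (far-is-chord near not-wrap))
  gap-colour {u = u} {v} (inj₂ (u≡ , v≡)) g not-wrap =
    trans (sym colouring u v) (gap-colour (inj₁ (v≡ , u≡)) g not-wrap)

  ends-min : ∀ {u v a b} → Ends u v a b → a ≤ b → toℕ u ⊓ toℕ v ≡ a
  ends-min (inj₁ (refl , refl)) a≤b = m≤n⇒m⊓n≡m a≤b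
  ends-min {u} {v} (inj₂ (refl , refl)) a≤b = trans (⊓-comm (toℕ u) (toℕ v)) (m≤n⇒m⊓n≡m a≤b)

  gap-not-wrap : ∀ {p a b} → Gap p a b → 4 ≤ n → 1 ≤ a ⊎ b < n
  gap-not-wrap {a = suc _} _ _ = inj₁ (s≤s z≤n)
  gap-not-wrap {a = zero} g 4≤n = inj₂ (≤-trans (s≤s (gap-high≤ g)) 4≤n)

  module Zigzag (s L : ℕ) (fits : s + L ≤ suc n) where

    label< : ∀ {j} → j < L → s + zigzag L j < suc n
    label< j<L = ≤-trans (+-monoʳ-< s (zigzag-< L j<L)) fits

    path : IndexedPath (suc n)
    path = record
      { len = L
      ; vertex = λ j → (s + zigzag L j) mod suc n
      ; position = λ v → zigzag L (toℕ v ∸ s)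
      ; position-vertex = λ {j} j<L → begin
          zigzag L (toℕ ((s + zigzag L j) mod suc n) ∸ s)  ≡⟨ cong (λ a → zigzag L (a ∸ s)) (toℕ-mod (label< j<L)) ⟩
          zigzag L (s + zigzag L j ∸ s)                    ≡⟨ cong (zigzag L) (m+n∸m≡n s _) ⟩
          zigzag L (zigzag L j)                            ≡⟨ zigzag-involutive L j<L ⟩
          j                                                ∎
      }

    open IndexedPath path using (vertex)
    open PathGraph path

    label : ∀ {j} → j < L → toℕ (vertex j) ≡ s + zigzag L j
    label j<L = toℕ-mod (label< j<L)

    covers : ∀ v → s ≤ toℕ v → toℕ v < s + L → v ∈ V graph
    covers v s≤v v<s+L = ∈graph⁺ (j<L , toℕ-injective (begin
      toℕ (vertex j)                    ≡⟨ label j<L ⟩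
      s + zigzag L (zigzag L (toℕ v ∸ s)) ≡⟨ cong (s +_) (zigzag-involutive L offset<L) ⟩
      s + (toℕ v ∸ s)                   ≡⟨ m+[n∸m]≡n s≤v ⟩
      toℕ v                             ∎))
      where
      offset<L : toℕ v ∸ s < L
      offset<L = subst (toℕ v ∸ s <_) (m+n∸m≡n s L) (∸-monoˡ-< v<s+L s≤v)
      j = zigzag L (toℕ v ∸ s)
      j<L = zigzag-< L offset<L

    above-s : ∀ {v} → v ∈ V graph → s ≤ toℕ v
    above-s {v} v∈ with ∈graph⁻ v∈
    ... | j<L , v≡ = subst (s ≤_) (trans (≡-sym (label j<L)) (cong toℕ v≡)) (m≤m+n s _)

    step-ends : ∀ j (sj<L : suc j < L) → let open ZigzagStep (zigzag-step L j sj<L) in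
      Ends (vertex j) (vertex (suc j)) (s + low) (s + high)
    step-ends j sj<L = Sum.map (λ (x , y) → relabel j<L x , relabel sj<L y)
                               (λ (x , y) → relabel j<L x , relabel sj<L y) ends
      where
      open ZigzagStep (zigzag-step L j sj<L)
      j<L = ≤-trans (n≤1+n _) sj<L
      relabel : ∀ {i a} → i < L → zigzag L i ≡ a → toℕ (vertex i) ≡ s + a
      relabel i<L e = trans (label i<L) (cong (s +_) e)

    -- each step is a cycle edge or a chord according to the parity of its
    -- index; the hypothesis excludes the wrap-around pair {0, n}
    step-colour : 1 ≤ s ⊎ 4 ≤ n → ∀ j → suc j < L →
      shade (vertex j) (vertex (suc j)) ≡ colourOf (parity j)
    step-colour room j sj<L = gap-colour (step-ends j sj<L) (gap-shift s gap) (not-wrap room)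
      where
      open ZigzagStep (zigzag-step L j sj<L)
      not-wrap : 1 ≤ s ⊎ 4 ≤ n → 1 ≤ s + low ⊎ s + high < n
      not-wrap (inj₁ 1≤s) = inj₁ (≤-trans 1≤s (m≤m+n s low))
      not-wrap (inj₂ 4≤n) = gap-not-wrap (gap-shift s gap) 4≤n

    alternating : 1 ≤ s ⊎ 4 ≤ n → Alternating colouring
    alternating room j ssj<L e = colour-alternates j (begin
      colourOf (parity j)                           ≡⟨ ≡-sym (step-colour room j (≤-trans (n≤1+n _) ssj<L)) ⟩
      shade (vertex j) (vertex (suc j))             ≡⟨ e ⟩
      shade (vertex (suc j)) (vertex (suc (suc j))) ≡⟨ step-colour room (suc j) ssj<L ⟩
      colourOf (parity (suc j))                     ∎)

    edge-parity : ∀ u v → Adj graph u v → lowParity u v ≡ parity s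
    edge-parity = edges-are-steps (λ u v → lowParity u v ≡ parity s)
      (λ {u} {v} e → trans (lowParity-sym v u) e) steps
      where
      steps : ∀ j → suc j < L → lowParity (vertex j) (vertex (suc j)) ≡ parity s
      steps j sj<L = begin
        lowParity (vertex j) (vertex (suc j))          ≡⟨ cong parity (ends-min (step-ends j sj<L) (gap-low≤high (gap-shift s gap))) ⟩
        parity (s + low)                               ≡⟨ +-homo-+ s low ⟩
        parity s +ℙ parity low                         ≡⟨ cong (parity s +ℙ_) low-even ⟩
        parity s +ℙ 0ℙ                                 ≡⟨ ℙ-+-identityʳ (parity s) ⟩
        parity s                                       ∎
        where open ZigzagStep (zigzag-step L j sj<L)

  module OddPath = Zigzag 1 n ≤-refl

  -- It forms an avoiding pair at 0 with any alternating spanning path whose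
  -- edges have an even smaller end: the smaller ends of its own edges are odd.
  pair-at-zero : (P : IndexedPath (suc n)) →
    (∀ v → v ∈ V (PathGraph.graph P)) → PathGraph.Alternating P colouring →
    (∀ u v → Adj (PathGraph.graph P) u v → lowParity u v ≡ 0ℙ) →
    AvoidingPair colouring zero
  pair-at-zero P spanning alternating even = record
    { tree₁ = Odd.graph
    ; tree₂ = Even.graph
    ; isTree₁ = Odd.is-tree
    ; isTree₂ = Even.is-tree
    ; proper₁ = Odd.proper colouring (OddPath.alternating (inj₁ ≤-refl))
    ; proper₂ = Even.proper colouring alternating
    ; covers₁ = λ v v≢0 → OddPath.covers v (nonzero v v≢0) (toℕ<n v)
    ; covers₂ = λ v _ → spanning v
    ; edge-disjoint = λ u v uv₁ uv₂ → 1≢0 (trans (≡-sym (OddPath.edge-parity u v uv₁)) (even u v uv₂))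
    ; not-both = λ 0∈₁ _ → 1≰0 (OddPath.above-s 0∈₁)
    }
    where
    module Odd = PathGraph OddPath.path
    module Even = PathGraph P
    nonzero : ∀ v → v ≢ zero → 1 ≤ toℕ v
    nonzero zero 0≢0 = ⊥-elim (0≢0 refl)
    nonzero (suc _) _ = s≤s z≤n
    1≢0 : 1ℙ ≢ 0ℙ
    1≢0 ()
    1≰0 : ¬ 1 ≤ 0
    1≰0 ()

  wide-pair-at-zero : 4 ≤ n → AvoidingPair colouring zero
  wide-pair-at-zero 4≤n = pair-at-zero EvenPath.path
    (λ v → EvenPath.covers v z≤n (toℕ<n v)) (EvenPath.alternating (inj₂ 4≤n)) EvenPath.edge-parity
    where module EvenPath = Zigzag 0 (suc n) ≤-refl

module K₄ where
  open CycleColouring 3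

  path : IndexedPath 4
  path = record
    { len = 4
    ; vertex = λ j → zigzag 2 j mod 4
    ; position = λ v → zigzag 2 (toℕ v)
    ; position-vertex = position-vertex
    }
    where
    position-vertex : ∀ {j} → j < 4 → zigzag 2 (toℕ (zigzag 2 j mod 4)) ≡ j
    position-vertex {0} _ = refl
    position-vertex {1} _ = refl
    position-vertex {2} _ = refl
    position-vertex {3} _ = refl
    position-vertex {suc (suc (suc (suc _)))} (s≤s (s≤s (s≤s (s≤s ()))))

  open IndexedPath path using (vertex)
  open PathGraph path

  pair-at-zero₄ : AvoidingPair colouring zero
  pair-at-zero₄ = pair-at-zero path spanning alternating edge-parity
    where
    decided : ∀ {v} → does (onPath? v) ≡ true → v ∈ V graph
    decided = ∈-tabulate⁺ {f = λ w → does (onPath? w)}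
    spanning : ∀ v → v ∈ V graph
    spanning zero = decided refl
    spanning (suc zero) = decided refl
    spanning (suc (suc zero)) = decided refl
    spanning (suc (suc (suc zero))) = decided refl
    alternating : Alternating colouring
    alternating 0 _ = λ ()
    alternating 1 _ = λ ()
    alternating (suc (suc _)) (s≤s (s≤s (s≤s (s≤s ()))))
    even-steps : ∀ j → suc j < 4 → lowParity (vertex j) (vertex (suc j)) ≡ 0ℙ
    even-steps 0 _ = refl
    even-steps 1 _ = refl
    even-steps 2 _ = refl
    even-steps (suc (suc (suc _))) (s≤s (s≤s (s≤s (s≤s ()))))
    edge-parity : ∀ u v → Adj graph u v → lowParity u v ≡ 0ℙ
    edge-parity = edges-are-steps (λ u v → lowParity u v ≡ 0ℙ)
      (λ {u} {v} e → trans (lowParity-sym v u) e) even-steps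

avoiding-pair-at-zero : ∀ k → AvoidingPair (CycleColouring.colouring (3 + k)) zero
avoiding-pair-at-zero zero = K₄.pair-at-zero₄
avoiding-pair-at-zero (suc k) = CycleColouring.wide-pair-at-zero (4 + k) (s≤s (s≤s (s≤s (s≤s z≤n))))

theorem2p5 : ∀ (n : ℕ) → 4 ≤ n → ProperIndexIs n (n ∸ 1) 2 2
theorem2p5 (suc (suc (suc (suc k)))) _ =
  (colouring , avoiding-pairs⇒good colouring every-pair) , fewer-than-two-colours-fail k
  where
  open CycleColouring (3 + k)
  every-pair : ∀ x → AvoidingPair colouring x
  every-pair = rotation-transitive (AvoidingPair colouring) (avoiding-pair-at-zero k)
                 (Relabel.transport rotation rotation-automorphism)
theorem2p5 zero ()
theorem2p5 (suc zero) (s≤s ())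
theorem2p5 (suc (suc zero)) (s≤s (s≤s ()))
theorem2p5 (suc (suc (suc zero))) (s≤s (s≤s (s≤s ())))
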